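{- Let $d>1$ be a square-free integer. If $x^2-dy^2=-1$ has integral solutions $(x,y)=(a_1,a_2)$ and $(x,y)=(b_1,b_2)$ with $|a_1|\neq|b_1|$, then the equation \[ (a-c)^2(b^2+1) = (b-c)^2(a^2+1) \] has the rational solutions \[ (a,b,c) = \pm\left( a_1,b_1,\frac{a_1b_2+a_2b_1}{b_2+a_2}\right),\qquad \pm\left( a_1,b_1,\frac{a_1b_2-a_2b_1}{b_2-a_2}\right). \] -}

module Defs where

open import Data.Nat as ℕ using (ℕ)
open import Data.Nat.Divisibility using (_∣_)
open import Data.Integer as ℤ using (ℤ; +_; -[1+_])
open import Data.Rational as ℚ using (ℚ; 0ℚ; 1ℚ; _≟_; _÷_; ≢-nonZero)
open import Relation.Nullary using (yes; no)
open import Relation.Binary.PropositionalEquality using (_≡_)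

SquareFree : ℕ → Set
SquareFree d = ∀ (p : ℕ) → p ℕ.* p ∣ d → p ≡ 1

NegPell : ℕ → ℤ → ℤ → Set
NegPell d x y = x ℤ.* x ℤ.- (+ d) ℤ.* (y ℤ.* y) ≡ ℤ.- (+ 1)

-- total division on ℚ (x / 0 := 0); used only where the denominator is
-- provably nonzero under the hypotheses
_÷₀_ : ℚ → ℚ → ℚ
p ÷₀ q with q ≟ 0ℚ
... | yes _ = 0ℚ
... | no q≢0 = _÷_ p q {{≢-nonZero q≢0}}

Eqn : ℚ → ℚ → ℚ → Set
Eqn a b c =
  ((a ℚ.- c) ℚ.* (a ℚ.- c)) ℚ.* (b ℚ.* b ℚ.+ 1ℚ)
    ≡ ((b ℚ.- c) ℚ.* (b ℚ.- c)) ℚ.* (a ℚ.* a ℚ.+ 1ℚ)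

ι : ℤ → ℚ
ι z = z ℚ./ 1

{-# OPTIONS --safe #-}
-- Over ℚ the Pell relations read a₁² + 1 = d a₂² and b₁² + 1 = d b₂², so the
-- equation becomes d ((a − c) b₂)² = d ((b − c) a₂)², which holds as soon as
-- (a − c) b₂ = −(b − c) a₂. Solving this linear equation for c gives the first
-- value; the second is the first with a₂ replaced by −a₂, which is again a
-- solution of the Pell equation. The denominator b₂ ± a₂ vanishes only if
-- a₂² = b₂², which forces a₁² = b₁², and the equation is invariant under
-- (a, b, c) ↦ −(a, b, c).
module Submission where

open import Defs
open import Data.Nat as ℕ using (ℕ)
open import Data.Integer as ℤ using (ℤ; +_)
open import Data.Rational as ℚ using (ℚ; 0ℚ; 1ℚ; _+_; _*_; _-_; -_)
open import Data.Rational.Unnormalised as ℚᵘ using (mkℚᵘ; *≡*)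
import Data.Rational.Unnormalised.Properties as ℚᵘP
import Data.Rational.Properties as ℚP
import Data.Integer.Properties as ℤP
import Data.Nat.Properties as ℕP
open import Data.Integer.Tactic.RingSolver using (solve-∀)
open import Data.Rational.Solver using (module +-*-Solver)
open import Data.Product using (_×_; _,_)
open import Relation.Nullary using (yes; no; contradiction)
open import Relation.Binary using (tri<; tri≈; tri>)
open import Relation.Binary.PropositionalEquality

Eqn-neg : ∀ a b c → Eqn a b c → Eqn (- a) (- b) (- c)
Eqn-neg a b c eqn = begin
  ((- a - - c) * (- a - - c)) * (- b * - b + 1ℚ)
    ≡⟨ solve 3 (λ a b c → ((:- a :- :- c) :* (:- a :- :- c)) :* (:- b :* :- b :+ con 1ℚ)
                       := ((a :- c) :* (a :- c)) :* (b :* b :+ con 1ℚ)) refl a b c ⟩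
  ((a - c) * (a - c)) * (b * b + 1ℚ)
    ≡⟨ eqn ⟩
  ((b - c) * (b - c)) * (a * a + 1ℚ)
    ≡⟨ solve 3 (λ a b c → ((b :- c) :* (b :- c)) :* (a :* a :+ con 1ℚ)
                       := ((:- b :- :- c) :* (:- b :- :- c)) :* (:- a :* :- a :+ con 1ℚ)) refl a b c ⟩
  ((- b - - c) * (- b - - c)) * (- a * - a + 1ℚ) ∎
  where open ≡-Reasoning; open +-*-Solver

Eqn-of-proportional : ∀ δ A A₂ B B₂ c →
  A * A + 1ℚ ≡ δ * (A₂ * A₂) → B * B + 1ℚ ≡ δ * (B₂ * B₂) →
  (A - c) * B₂ ≡ - ((B - c) * A₂) → Eqn A B c
Eqn-of-proportional δ A A₂ B B₂ c pellA pellB proportional = begin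
  ((A - c) * (A - c)) * (B * B + 1ℚ)
    ≡⟨ cong (((A - c) * (A - c)) *_) pellB ⟩
  ((A - c) * (A - c)) * (δ * (B₂ * B₂))
    ≡⟨ solve 3 (λ X δ B₂ → (X :* X) :* (δ :* (B₂ :* B₂)) := δ :* ((X :* B₂) :* (X :* B₂)))
             refl (A - c) δ B₂ ⟩
  δ * (((A - c) * B₂) * ((A - c) * B₂))
    ≡⟨ cong (λ t → δ * (t * t)) proportional ⟩
  δ * (- ((B - c) * A₂) * - ((B - c) * A₂))
    ≡⟨ solve 3 (λ Y δ A₂ → δ :* (:- (Y :* A₂) :* :- (Y :* A₂)) := (Y :* Y) :* (δ :* (A₂ :* A₂)))
             refl (B - c) δ A₂ ⟩
  ((B - c) * (B - c)) * (δ * (A₂ * A₂))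
    ≡⟨ cong (((B - c) * (B - c)) *_) pellA ⟨
  ((B - c) * (B - c)) * (A * A + 1ℚ) ∎
  where open ≡-Reasoning; open +-*-Solver

*-÷₀-cancel : ∀ p {q} → q ≢ 0ℚ → q * (p ÷₀ q) ≡ p
*-÷₀-cancel p {q} q≢0 with q ℚ.≟ 0ℚ
... | yes q≡0 = contradiction q≡0 q≢0
... | no q≢0′ = begin
  q * (p * ℚ.1/ q) ≡⟨ solve 3 (λ q p r → q :* (p :* r) := p :* (q :* r)) refl q p (ℚ.1/ q) ⟩
  p * (q * ℚ.1/ q) ≡⟨ cong (p *_) (ℚP.*-inverseʳ q) ⟩
  p * 1ℚ           ≡⟨ ℚP.*-identityʳ p ⟩
  p                ∎
  where open ≡-Reasoning; open +-*-Solver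
        instance _ = ℚ.≢-nonZero q≢0′

Eqn-solution : ∀ δ A A₂ B B₂ →
  A * A + 1ℚ ≡ δ * (A₂ * A₂) → B * B + 1ℚ ≡ δ * (B₂ * B₂) → B₂ + A₂ ≢ 0ℚ →
  Eqn A B ((A * B₂ + A₂ * B) ÷₀ (B₂ + A₂))
Eqn-solution δ A A₂ B B₂ pellA pellB B₂+A₂≢0 =
  Eqn-of-proportional δ A A₂ B B₂ c pellA pellB proportional
  where
  open ≡-Reasoning; open +-*-Solver
  N = A * B₂ + A₂ * B
  c = N ÷₀ (B₂ + A₂)
  proportional : (A - c) * B₂ ≡ - ((B - c) * A₂)
  proportional = begin
    (A - c) * B₂
      ≡⟨ solve 5 (λ A A₂ B B₂ c → (A :- c) :* B₂
                    := ((A :* B₂ :+ A₂ :* B) :- (B₂ :+ A₂) :* c) :- (B :- c) :* A₂)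
               refl A A₂ B B₂ c ⟩
    (N - (B₂ + A₂) * c) - (B - c) * A₂
      ≡⟨ cong (λ t → (N - t) - (B - c) * A₂) (*-÷₀-cancel N B₂+A₂≢0) ⟩
    (N - N) - (B - c) * A₂
      ≡⟨ solve 2 (λ N Y → (N :- N) :- Y := :- Y) refl N ((B - c) * A₂) ⟩
    - ((B - c) * A₂) ∎

fromℚᵘ-homo-+ : ∀ p q → ℚ.fromℚᵘ (p ℚᵘ.+ q) ≡ ℚ.fromℚᵘ p + ℚ.fromℚᵘ q
fromℚᵘ-homo-+ p q = ℚP.toℚᵘ-injective (begin-equality
  ℚ.toℚᵘ (ℚ.fromℚᵘ (p ℚᵘ.+ q))                  ≃⟨ ℚP.toℚᵘ-fromℚᵘ (p ℚᵘ.+ q) ⟩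
  p ℚᵘ.+ q                                        ≃⟨ ℚᵘP.+-cong (ℚP.toℚᵘ-fromℚᵘ p) (ℚP.toℚᵘ-fromℚᵘ q) ⟨
  ℚ.toℚᵘ (ℚ.fromℚᵘ p) ℚᵘ.+ ℚ.toℚᵘ (ℚ.fromℚᵘ q)  ≃⟨ ℚP.toℚᵘ-homo-+ (ℚ.fromℚᵘ p) (ℚ.fromℚᵘ q) ⟨
  ℚ.toℚᵘ (ℚ.fromℚᵘ p + ℚ.fromℚᵘ q)              ∎)
  where open ℚᵘP.≤-Reasoning

fromℚᵘ-homo-* : ∀ p q → ℚ.fromℚᵘ (p ℚᵘ.* q) ≡ ℚ.fromℚᵘ p * ℚ.fromℚᵘ q
fromℚᵘ-homo-* p q = ℚP.toℚᵘ-injective (begin-equality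
  ℚ.toℚᵘ (ℚ.fromℚᵘ (p ℚᵘ.* q))                  ≃⟨ ℚP.toℚᵘ-fromℚᵘ (p ℚᵘ.* q) ⟩
  p ℚᵘ.* q                                        ≃⟨ ℚᵘP.*-cong (ℚP.toℚᵘ-fromℚᵘ p) (ℚP.toℚᵘ-fromℚᵘ q) ⟨
  ℚ.toℚᵘ (ℚ.fromℚᵘ p) ℚᵘ.* ℚ.toℚᵘ (ℚ.fromℚᵘ q)  ≃⟨ ℚP.toℚᵘ-homo-* (ℚ.fromℚᵘ p) (ℚ.fromℚᵘ q) ⟨
  ℚ.toℚᵘ (ℚ.fromℚᵘ p * ℚ.fromℚᵘ q)              ∎)
  where open ℚᵘP.≤-Reasoning

-- ι x is by definition ℚ.fromℚᵘ (mkℚᵘ x 0), the fraction x / 1.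
ι-homo-+ : ∀ x y → ι (x ℤ.+ y) ≡ ι x + ι y
ι-homo-+ x y = trans
  (ℚP.fromℚᵘ-cong {mkℚᵘ (x ℤ.+ y) 0} {mkℚᵘ x 0 ℚᵘ.+ mkℚᵘ y 0} (*≡* (cross-multiplied x y)))
  (fromℚᵘ-homo-+ (mkℚᵘ x 0) (mkℚᵘ y 0))
  where
  cross-multiplied : ∀ x y → (x ℤ.+ y) ℤ.* ℤ.1ℤ ≡ (x ℤ.* ℤ.1ℤ ℤ.+ y ℤ.* ℤ.1ℤ) ℤ.* ℤ.1ℤ
  cross-multiplied = solve-∀

ι-homo-* : ∀ x y → ι (x ℤ.* y) ≡ ι x * ι y
ι-homo-* x y = fromℚᵘ-homo-* (mkℚᵘ x 0) (mkℚᵘ y 0)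

ι-injective : ∀ {x y} → ι x ≡ ι y → x ≡ y
ι-injective {x} {y} ιx≡ιy with ℚP.fromℚᵘ-injective {mkℚᵘ x 0} {mkℚᵘ y 0} ιx≡ιy
... | *≡* x*1≡y*1 = trans (sym (ℤP.*-identityʳ x)) (trans x*1≡y*1 (ℤP.*-identityʳ y))

m*m≡n*n⇒m≡n : ∀ m n → m ℕ.* m ≡ n ℕ.* n → m ≡ n
m*m≡n*n⇒m≡n m n m*m≡n*n with ℕP.<-cmp m n
... | tri< m<n _ _ = contradiction m*m≡n*n (ℕP.<⇒≢ (ℕP.*-mono-< m<n m<n))
... | tri≈ _ m≡n _ = m≡n
... | tri> _ _ n<m = contradiction (sym m*m≡n*n) (ℕP.<⇒≢ (ℕP.*-mono-< n<m n<m))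

i*i≡j*j⇒∣i∣≡∣j∣ : ∀ i j → i ℤ.* i ≡ j ℤ.* j → ℤ.∣ i ∣ ≡ ℤ.∣ j ∣
i*i≡j*j⇒∣i∣≡∣j∣ i j i*i≡j*j =
  m*m≡n*n⇒m≡n ℤ.∣ i ∣ ℤ.∣ j ∣
    (trans (sym (ℤP.abs-* i i)) (trans (cong ℤ.∣_∣ i*i≡j*j) (ℤP.abs-* j j)))

i+j≡0⇒i*i≡j*j : ∀ i j → i ℤ.+ j ≡ ℤ.0ℤ → i ℤ.* i ≡ j ℤ.* j
i+j≡0⇒i*i≡j*j i j i+j≡0 = begin
  i ℤ.* i                                      ≡⟨ difference-of-squares i j ⟩
  j ℤ.* j ℤ.+ (i ℤ.+ j) ℤ.* (i ℤ.- j)          ≡⟨ cong (λ t → j ℤ.* j ℤ.+ t ℤ.* (i ℤ.- j)) i+j≡0 ⟩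
  j ℤ.* j ℤ.+ ℤ.0ℤ                              ≡⟨ ℤP.+-identityʳ (j ℤ.* j) ⟩
  j ℤ.* j                                      ∎
  where
  open ≡-Reasoning
  difference-of-squares : ∀ i j → i ℤ.* i ≡ j ℤ.* j ℤ.+ (i ℤ.+ j) ℤ.* (i ℤ.- j)
  difference-of-squares = solve-∀

NegPell⇒sq+1≡ : ∀ d x y → NegPell d x y → x ℤ.* x ℤ.+ ℤ.1ℤ ≡ + d ℤ.* (y ℤ.* y)
NegPell⇒sq+1≡ d x y pell = begin
  x ℤ.* x ℤ.+ ℤ.1ℤ                       ≡⟨ regroup (x ℤ.* x) D ⟩
  (x ℤ.* x ℤ.- D) ℤ.+ ℤ.1ℤ ℤ.+ D          ≡⟨ cong (λ t → t ℤ.+ ℤ.1ℤ ℤ.+ D) pell ⟩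
  ℤ.- (+ 1) ℤ.+ ℤ.1ℤ ℤ.+ D               ≡⟨ ℤP.+-identityˡ D ⟩
  D                                      ∎
  where
  open ≡-Reasoning
  D = + d ℤ.* (y ℤ.* y)
  regroup : ∀ s t → s ℤ.+ ℤ.1ℤ ≡ (s ℤ.- t) ℤ.+ ℤ.1ℤ ℤ.+ t
  regroup = solve-∀

NegPell-neg : ∀ d x y → NegPell d x y → NegPell d x (ℤ.- y)
NegPell-neg d x y = subst (λ t → x ℤ.* x ℤ.- + d ℤ.* t ≡ ℤ.- (+ 1)) (neg-square y)
  where
  neg-square : ∀ y → y ℤ.* y ≡ ℤ.- y ℤ.* ℤ.- y
  neg-square = solve-∀

NegPell-sq≡ : ∀ d a₁ a₂ b₁ b₂ → NegPell d a₁ a₂ → NegPell d b₁ b₂ →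
  a₂ ℤ.* a₂ ≡ b₂ ℤ.* b₂ → a₁ ℤ.* a₁ ≡ b₁ ℤ.* b₁
NegPell-sq≡ d a₁ a₂ b₁ b₂ pellA pellB a₂²≡b₂² = begin
  a₁ ℤ.* a₁                        ≡⟨ add-sub (a₁ ℤ.* a₁) ⟩
  a₁ ℤ.* a₁ ℤ.+ ℤ.1ℤ ℤ.- ℤ.1ℤ       ≡⟨ cong (ℤ._- ℤ.1ℤ) a₁²+1≡b₁²+1 ⟩
  b₁ ℤ.* b₁ ℤ.+ ℤ.1ℤ ℤ.- ℤ.1ℤ       ≡⟨ add-sub (b₁ ℤ.* b₁) ⟨
  b₁ ℤ.* b₁                        ∎
  where
  open ≡-Reasoning
  add-sub : ∀ s → s ≡ s ℤ.+ ℤ.1ℤ ℤ.- ℤ.1ℤ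
  add-sub = solve-∀
  a₁²+1≡b₁²+1 : a₁ ℤ.* a₁ ℤ.+ ℤ.1ℤ ≡ b₁ ℤ.* b₁ ℤ.+ ℤ.1ℤ
  a₁²+1≡b₁²+1 = trans (NegPell⇒sq+1≡ d a₁ a₂ pellA)
                 (trans (cong (+ d ℤ.*_) a₂²≡b₂²) (sym (NegPell⇒sq+1≡ d b₁ b₂ pellB)))

NegPell⇒ι-sq+1≡ : ∀ d x y → NegPell d x y → ι x * ι x + 1ℚ ≡ ι (+ d) * (ι y * ι y)
NegPell⇒ι-sq+1≡ d x y pell = begin
  ι x * ι x + 1ℚ             ≡⟨ cong (_+ 1ℚ) (ι-homo-* x x) ⟨
  ι (x ℤ.* x) + ι ℤ.1ℤ        ≡⟨ ι-homo-+ (x ℤ.* x) ℤ.1ℤ ⟨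
  ι (x ℤ.* x ℤ.+ ℤ.1ℤ)        ≡⟨ cong ι (NegPell⇒sq+1≡ d x y pell) ⟩
  ι (+ d ℤ.* (y ℤ.* y))       ≡⟨ ι-homo-* (+ d) (y ℤ.* y) ⟩
  ι (+ d) * ι (y ℤ.* y)       ≡⟨ cong (ι (+ d) *_) (ι-homo-* y y) ⟩
  ι (+ d) * (ι y * ι y)       ∎
  where open ≡-Reasoning

NegPell⇒Eqn : ∀ d a₁ a₂ b₁ b₂ → NegPell d a₁ a₂ → NegPell d b₁ b₂ →
  ℤ.∣ a₁ ∣ ≢ ℤ.∣ b₁ ∣ →
  Eqn (ι a₁) (ι b₁) (ι (a₁ ℤ.* b₂ ℤ.+ a₂ ℤ.* b₁) ÷₀ ι (b₂ ℤ.+ a₂))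
NegPell⇒Eqn d a₁ a₂ b₁ b₂ pellA pellB ∣a₁∣≢∣b₁∣ =
  subst (Eqn (ι a₁) (ι b₁)) (sym (cong₂ _÷₀_ ι-numerator (ι-homo-+ b₂ a₂)))
    (Eqn-solution (ι (+ d)) (ι a₁) (ι a₂) (ι b₁) (ι b₂)
      (NegPell⇒ι-sq+1≡ d a₁ a₂ pellA) (NegPell⇒ι-sq+1≡ d b₁ b₂ pellB) denominator≢0)
  where
  ι-numerator : ι (a₁ ℤ.* b₂ ℤ.+ a₂ ℤ.* b₁) ≡ ι a₁ * ι b₂ + ι a₂ * ι b₁
  ι-numerator = trans (ι-homo-+ (a₁ ℤ.* b₂) (a₂ ℤ.* b₁))
                      (cong₂ _+_ (ι-homo-* a₁ b₂) (ι-homo-* a₂ b₁))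
  denominator≢0 : ι b₂ + ι a₂ ≢ 0ℚ
  denominator≢0 ιb₂+ιa₂≡0 = ∣a₁∣≢∣b₁∣ (i*i≡j*j⇒∣i∣≡∣j∣ a₁ b₁
    (NegPell-sq≡ d a₁ a₂ b₁ b₂ pellA pellB (sym (i+j≡0⇒i*i≡j*j b₂ a₂ b₂+a₂≡0))))
    where
    b₂+a₂≡0 : b₂ ℤ.+ a₂ ≡ ℤ.0ℤ
    b₂+a₂≡0 = ι-injective (trans (ι-homo-+ b₂ a₂) ιb₂+ιa₂≡0)

lemma3p1 : (d : ℕ) → 1 ℕ.< d → SquareFree d →
    (a₁ a₂ b₁ b₂ : ℤ) → NegPell d a₁ a₂ → NegPell d b₁ b₂ →
    ℤ.∣ a₁ ∣ ≢ ℤ.∣ b₁ ∣ →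
    let A = ι a₁ in
    let B = ι b₁ in
    let c₁ = ι (a₁ ℤ.* b₂ ℤ.+ a₂ ℤ.* b₁) ÷₀ ι (b₂ ℤ.+ a₂) in
    let c₂ = ι (a₁ ℤ.* b₂ ℤ.- a₂ ℤ.* b₁) ÷₀ ι (b₂ ℤ.- a₂) in
    (Eqn A B c₁ × Eqn (ℚ.- A) (ℚ.- B) (ℚ.- c₁))
       × (Eqn A B c₂ × Eqn (ℚ.- A) (ℚ.- B) (ℚ.- c₂))
lemma3p1 d _ _ a₁ a₂ b₁ b₂ pellA pellB ∣a₁∣≢∣b₁∣ =
  (sol₁ , Eqn-neg A B c₁ sol₁) , (sol₂ , Eqn-neg A B c₂ sol₂)
  where
  A = ι a₁
  B = ι b₁
  c₁ = ι (a₁ ℤ.* b₂ ℤ.+ a₂ ℤ.* b₁) ÷₀ ι (b₂ ℤ.+ a₂)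
  c₂ = ι (a₁ ℤ.* b₂ ℤ.- a₂ ℤ.* b₁) ÷₀ ι (b₂ ℤ.- a₂)
  sol₁ : Eqn A B c₁
  sol₁ = NegPell⇒Eqn d a₁ a₂ b₁ b₂ pellA pellB ∣a₁∣≢∣b₁∣
  sol₂ : Eqn A B c₂
  sol₂ = subst (λ n → Eqn A B (ι (a₁ ℤ.* b₂ ℤ.+ n) ÷₀ ι (b₂ ℤ.- a₂)))
           (sym (ℤP.neg-distribˡ-* a₂ b₁))
           (NegPell⇒Eqn d a₁ (ℤ.- a₂) b₁ b₂ (NegPell-neg d a₁ a₂ pellA) pellB ∣a₁∣≢∣b₁∣)
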